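{- Let $n\ge 10$. Suppose $T$ is a rooted tree whose vertex set is $\mathbf{A}(n)$, with root $\rho$, in which each non-root vertex $\alpha$ is assigned an operation $\mathrm{op}_\alpha\in\{\mathrm{FirstOne},\mathrm{LastOne},\mathrm{FirstZero},\mathrm{LastZero}\}$ such that the parent of $\alpha$ in $T$ is $\mathrm{op}_\alpha(\alpha)$. Then at least three distinct operations occur among the $\mathrm{op}_\alpha$, $\alpha\in\mathbf{A}(n)\setminus\{\rho\}$.
   Context: Binary strings are compared lexicographically with $0<1$ (a proper prefix is smaller). For $\alpha=a_1\cdots a_n$, $\alpha^R=a_n\cdots a_1$. $[\alpha]$ is the set of rotations of $\alpha$; $\alpha$ is a necklace if it is lexicographically smallest in $[\alpha]$, and a bracelet if lexicographically smallest in $[\alpha]\cup[\alpha^R]$. A necklace $\alpha$ is symmetric if $\alpha^R\in[\alpha]$, otherwise asymmetric. $\mathbf{A}(n)$ is the set of length-$n$ bracelets that are not symmetric (asymmetric bracelets); every element begins with $0$ and ends with $1$. For $\alpha=a_1\cdots a_n\in\mathbf{A}(n)$: $\mathrm{FirstOne}(\alpha)$ is $\alpha$ with its first $1$ flipped to $0$; $\mathrm{LastOne}(\alpha)$ is the necklace (lexicographically smallest rotation) of $a_1\cdots a_{n-1}0$; $\mathrm{FirstZero}(\alpha)$ is the necklace of $1a_2\cdots a_n$; $\mathrm{LastZero}(\alpha)$ is $\alpha$ with its last $0$ flipped to $1$. -}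

module Defs where

open import Data.Bool using (Bool; true; false; if_then_else_)
open import Data.List using (List; []; _∷_; _++_; [_]; length; reverse)
open import Data.Nat using (ℕ; zero; suc; _<_)
open import Data.Product using (Σ; _×_; ∃; ∃-syntax)
open import Relation.Binary.PropositionalEquality using (_≡_)
open import Relation.Nullary using (¬_)

-- Binary strings: 0 = false, 1 = true.
BStr : Set
BStr = List Bool

leq : BStr → BStr → Bool
leq []           _            = true
leq (_ ∷ _)      []           = false
leq (false ∷ xs) (false ∷ ys) = leq xs ys
leq (true ∷ xs)  (true ∷ ys)  = leq xs ys
leq (false ∷ _)  (true ∷ _)   = true
leq (true ∷ _)   (false ∷ _)  = false

_≤L_ : BStr → BStr → Set
α ≤L β = leq α β ≡ true

rotate : ℕ → BStr → BStr
rotate zero    xs       = xs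
rotate (suc k) []       = []
rotate (suc k) (x ∷ xs) = rotate k (xs ++ [ x ])

InRotations : BStr → BStr → Set
InRotations β α = ∃[ k ] (k < length α × β ≡ rotate k α)

IsNecklace : BStr → Set
IsNecklace α = ∀ β → InRotations β α → α ≤L β

IsBracelet : BStr → Set
IsBracelet α = ∀ β → (InRotations β α → α ≤L β) × (InRotations β (reverse α) → α ≤L β)

IsSymmetric : BStr → Set
IsSymmetric α = InRotations (reverse α) α

InA : ℕ → BStr → Set
InA n α = length α ≡ n × IsBracelet α × ¬ IsSymmetric α

neckAux : ℕ → BStr → BStr → BStr
neckAux zero    xs best = best
neckAux (suc k) xs best =
  let r = rotate k xs in neckAux k xs (if leq r best then r else best)

neck : BStr → BStr
neck xs = neckAux (length xs) xs xs

flipFirstOne : BStr → BStr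
flipFirstOne []           = []
flipFirstOne (true ∷ xs)  = false ∷ xs
flipFirstOne (false ∷ xs) = false ∷ flipFirstOne xs

flipFirstZero : BStr → BStr
flipFirstZero []           = []
flipFirstZero (false ∷ xs) = true ∷ xs
flipFirstZero (true ∷ xs)  = true ∷ flipFirstZero xs

lastTo0 : BStr → BStr
lastTo0 []           = []
lastTo0 (x ∷ [])     = false ∷ []
lastTo0 (x ∷ y ∷ xs) = x ∷ lastTo0 (y ∷ xs)

firstTo1 : BStr → BStr
firstTo1 []       = []
firstTo1 (_ ∷ xs) = true ∷ xs

FirstOne LastOne FirstZero LastZero : BStr → BStr
FirstOne α  = flipFirstOne α
LastOne α   = neck (lastTo0 α)
FirstZero α = neck (firstTo1 α)
LastZero α  = reverse (flipFirstZero (reverse α))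

data Op : Set where
  firstOne lastOne firstZero lastZero : Op

apply : Op → BStr → BStr
apply firstOne  = FirstOne
apply lastOne   = LastOne
apply firstZero = FirstZero
apply lastZero  = LastZero

iter : ℕ → (BStr → BStr) → BStr → BStr
iter zero    f x = x
iter (suc k) f x = iter k f (f x)

record IsOpTree (n : ℕ) (ρ : BStr) (op : BStr → Op) : Set where
  field
    root∈A    : InA n ρ
    parent∈A  : ∀ α → InA n α → ¬ α ≡ ρ → InA n (apply (op α) α)
    reachRoot : ∀ α → InA n α → ∃[ k ] iter k (λ β → apply (op β) β) α ≡ ρ

-- For n = 10 + k, six explicit strings lie in A(n), and for each of them we know which
-- operations keep it inside A(n):
--   0^(6+k) 1011         only FirstZero,
--   0010 1^(6+k)         only LastOne,
--   0010 1^(3+k) 011     only LastZero,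
--   0^(4+k) 110111       neither LastOne nor LastZero,
--   00110 1^(5+k)        neither FirstZero nor LastZero,
--   0010 1^(1+k) 01011   neither FirstZero nor LastOne.
-- An image falls outside A(n) either because its rotation class is symmetric or because
-- some rotation of its reversal is smaller than all of its rotations. If the root is the
-- first string, the second, third and fourth are non-root vertices with pairwise distinct
-- operations; if it is the second, take the first, third and fifth; otherwise take the
-- first two together with whichever of the third and sixth is not the root. Only the fact
-- that parents of non-root vertices lie in A(n) is used, not that the tree is connected.

module Submission where

open import Data.Bool using (Bool; true; false; _∧_; _≟_)
open import Data.Empty using (⊥-elim)
open import Function using (_∘_)
open import Data.List using ([]; _∷_; _++_; [_]; length; reverse; replicate; drop; take)
open import Data.List.Properties
  using (++-assoc; ++-identityʳ; length-++; length-replicate; length-reverse; reverse-++; unfold-reverse; ≡-dec)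
open import Data.Nat using (ℕ; zero; suc; _+_; _*_; _∸_; _<_; _≤_; z≤n; s≤s)
open import Data.Nat.DivMod using (_%_; _/_; m≡m%n+[m/n]*n; m%n<n)
open import Data.Nat.Properties
  using (+-comm; +-suc; *-suc; <⇒≤; +-cancelˡ-<; m<n+m; m≤n⇒∃[o]m+o≡n)
open import Data.Product using (_×_; _,_; ∃-syntax; ∃₂; proj₂)
open import Data.Sum using (_⊎_; inj₁; inj₂)
open import Relation.Binary.PropositionalEquality
  using (_≡_; _≢_; refl; sym; trans; cong; subst; module ≡-Reasoning)
open import Relation.Nullary using (¬_; Dec; yes; no)

open import Defs
open ≡-Reasoning

pattern O = false
pattern I = true

zeros ones : ℕ → BStr
zeros m = replicate m false
ones m = replicate m true

<⊎≡+ : ∀ i m → i < m ⊎ ∃[ t ] i ≡ m + t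
<⊎≡+ zero    zero    = inj₂ (0 , refl)
<⊎≡+ zero    (suc m) = inj₁ (s≤s z≤n)
<⊎≡+ (suc i) zero    = inj₂ (suc i , refl)
<⊎≡+ (suc i) (suc m) with <⊎≡+ i m
... | inj₁ i<m       = inj₁ (s≤s i<m)
... | inj₂ (t , eq)  = inj₂ (t , cong suc eq)

<⇒≡+suc : ∀ {j r} → j < r → ∃[ d ] r ≡ j + suc d
<⇒≡+suc {j} j<r with m≤n⇒∃[o]m+o≡n j<r
... | d , refl = d , sym (+-suc j d)

replicate-+ : ∀ m n (x : Bool) → replicate (m + n) x ≡ replicate m x ++ replicate n x
replicate-+ zero    n x = refl
replicate-+ (suc m) n x = cong (x ∷_) (replicate-+ m n x)

replicate-∷ʳ : ∀ m (x : Bool) ys → replicate m x ++ x ∷ ys ≡ x ∷ replicate m x ++ ys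
replicate-∷ʳ zero    x ys = refl
replicate-∷ʳ (suc m) x ys = cong (x ∷_) (replicate-∷ʳ m x ys)

replicate-++-swap : ∀ m j (x : Bool) ys →
                    replicate m x ++ replicate j x ++ ys ≡ replicate j x ++ replicate m x ++ ys
replicate-++-swap m zero    x ys = refl
replicate-++-swap m (suc j) x ys = trans (replicate-∷ʳ m x _) (cong (x ∷_) (replicate-++-swap m j x ys))

reverse-replicate : ∀ m (x : Bool) → reverse (replicate m x) ≡ replicate m x
reverse-replicate zero    x = refl
reverse-replicate (suc m) x = begin
  reverse (x ∷ replicate m x)        ≡⟨ unfold-reverse x (replicate m x) ⟩
  reverse (replicate m x) ++ [ x ]   ≡⟨ cong (_++ [ x ]) (reverse-replicate m x) ⟩
  replicate m x ++ [ x ]             ≡⟨ replicate-∷ʳ m x [] ⟩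
  x ∷ replicate m x ++ []            ≡⟨ cong (x ∷_) (++-identityʳ _) ⟩
  x ∷ replicate m x                  ∎

reverse-++-replicate : ∀ m (x : Bool) ys → reverse (ys ++ replicate m x) ≡ replicate m x ++ reverse ys
reverse-++-replicate m x ys = trans (reverse-++ ys _) (cong (_++ reverse ys) (reverse-replicate m x))

reverse-replicate-++ : ∀ m (x : Bool) ys → reverse (replicate m x ++ ys) ≡ reverse ys ++ replicate m x
reverse-replicate-++ m x ys =
  trans (reverse-++ (replicate m x) ys) (cong (reverse ys ++_) (reverse-replicate m x))

reverse-++-replicate-++ : ∀ xs m (x : Bool) ys →
  reverse (xs ++ replicate m x ++ ys) ≡ reverse ys ++ replicate m x ++ reverse xs
reverse-++-replicate-++ xs m x ys = begin
  reverse (xs ++ replicate m x ++ ys)                ≡⟨ reverse-++ xs _ ⟩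
  reverse (replicate m x ++ ys) ++ reverse xs        ≡⟨ cong (_++ reverse xs) (reverse-replicate-++ m x ys) ⟩
  (reverse ys ++ replicate m x) ++ reverse xs        ≡⟨ ++-assoc (reverse ys) _ _ ⟩
  reverse ys ++ replicate m x ++ reverse xs          ∎

length-replicate-++ : ∀ m (x : Bool) ys → length (replicate m x ++ ys) ≡ m + length ys
length-replicate-++ m x ys = trans (length-++ (replicate m x)) (cong (_+ length ys) (length-replicate m))

reverse-≢ : ∀ {x y x′ y′ : BStr} → reverse x ≡ x′ → reverse y ≡ y′ → x′ ≢ y′ → x ≢ y
reverse-≢ refl refl x′≢y′ refl = x′≢y′ refl

-- Rotations

rotate-[] : ∀ k → rotate k [] ≡ []
rotate-[] zero    = refl
rotate-[] (suc k) = refl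

rotate-+ : ∀ i j (xs : BStr) → rotate (i + j) xs ≡ rotate j (rotate i xs)
rotate-+ zero    j xs       = refl
rotate-+ (suc i) j []       = sym (rotate-[] j)
rotate-+ (suc i) j (x ∷ xs) = rotate-+ i j (xs ++ [ x ])

rotate-++ : ∀ (xs ys : BStr) → rotate (length xs) (xs ++ ys) ≡ ys ++ xs
rotate-++ []       ys = sym (++-identityʳ ys)
rotate-++ (x ∷ xs) ys = begin
  rotate (length xs) ((xs ++ ys) ++ [ x ])   ≡⟨ cong (rotate (length xs)) (++-assoc xs ys [ x ]) ⟩
  rotate (length xs) (xs ++ ys ++ [ x ])     ≡⟨ rotate-++ xs (ys ++ [ x ]) ⟩
  (ys ++ [ x ]) ++ xs                        ≡⟨ ++-assoc ys [ x ] xs ⟩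
  ys ++ x ∷ xs                               ∎

rotate-++-+ : ∀ (xs ys : BStr) i → rotate (length xs + i) (xs ++ ys) ≡ rotate i (ys ++ xs)
rotate-++-+ xs ys i = trans (rotate-+ (length xs) i (xs ++ ys)) (cong (rotate i) (rotate-++ xs ys))

rotate-replicate-++ : ∀ k (x : Bool) ys → rotate k (replicate k x ++ ys) ≡ ys ++ replicate k x
rotate-replicate-++ k x ys =
  trans (cong (λ l → rotate l (replicate k x ++ ys)) (sym (length-replicate k))) (rotate-++ (replicate k x) ys)

rotate-replicate-< : ∀ {i r} → i < r → ∀ (x : Bool) xs →
  ∃[ d ] r ≡ i + suc d × rotate i (replicate r x ++ xs) ≡ replicate (suc d) x ++ xs ++ replicate i x
rotate-replicate-< {i} i<r x xs with <⇒≡+suc i<r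
... | d , refl = d , refl , (begin
  rotate i (replicate (i + suc d) x ++ xs)
    ≡⟨ cong (λ l → rotate i (l ++ xs)) (replicate-+ i (suc d) x) ⟩
  rotate i ((replicate i x ++ replicate (suc d) x) ++ xs)
    ≡⟨ cong (rotate i) (++-assoc (replicate i x) _ xs) ⟩
  rotate i (replicate i x ++ replicate (suc d) x ++ xs)
    ≡⟨ rotate-replicate-++ i x _ ⟩
  (replicate (suc d) x ++ xs) ++ replicate i x
    ≡⟨ ++-assoc (replicate (suc d) x) xs _ ⟩
  replicate (suc d) x ++ xs ++ replicate i x
    ∎)

rotate-zeros : ∀ {i r} → 0 < i → i < r → ∀ xs →
               ∃[ d ] d < r × rotate i (zeros r ++ xs) ≡ zeros d ++ xs ++ zeros i
rotate-zeros {i} 0<i i<r xs with rotate-replicate-< i<r false xs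
... | d , refl , eq = suc d , m<n+m (suc d) 0<i , eq

rotate-drop-take : ∀ i (xs ys : BStr) → i ≤ length xs → rotate i (xs ++ ys) ≡ drop i xs ++ ys ++ take i xs
rotate-drop-take zero    xs       ys _         = cong (xs ++_) (sym (++-identityʳ ys))
rotate-drop-take (suc i) (x ∷ xs) ys (s≤s i≤) = begin
  rotate i ((xs ++ ys) ++ [ x ])             ≡⟨ cong (rotate i) (++-assoc xs ys [ x ]) ⟩
  rotate i (xs ++ ys ++ [ x ])               ≡⟨ rotate-drop-take i xs (ys ++ [ x ]) i≤ ⟩
  drop i xs ++ (ys ++ [ x ]) ++ take i xs    ≡⟨ cong (drop i xs ++_) (++-assoc ys [ x ] (take i xs)) ⟩
  drop i xs ++ ys ++ x ∷ take i xs           ∎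

length-rotate : ∀ k (xs : BStr) → length (rotate k xs) ≡ length xs
length-rotate zero    xs       = refl
length-rotate (suc k) []       = refl
length-rotate (suc k) (x ∷ xs) =
  trans (length-rotate k (xs ++ [ x ])) (trans (length-++ xs) (+-comm (length xs) 1))

rotate-length : ∀ (xs : BStr) → rotate (length xs) xs ≡ xs
rotate-length xs = trans (cong (rotate (length xs)) (sym (++-identityʳ xs))) (rotate-++ xs [])

rotate-*-length : ∀ q (xs : BStr) → rotate (q * length xs) xs ≡ xs
rotate-*-length zero    xs = refl
rotate-*-length (suc q) xs = begin
  rotate (length xs + q * length xs) xs          ≡⟨ rotate-+ (length xs) (q * length xs) xs ⟩
  rotate (q * length xs) (rotate (length xs) xs) ≡⟨ cong (rotate (q * length xs)) (rotate-length xs) ⟩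
  rotate (q * length xs) xs                      ≡⟨ rotate-*-length q xs ⟩
  xs                                             ∎

reverse-rotate₁ : ∀ (xs : BStr) → reverse (rotate 1 xs) ≡ rotate (length xs ∸ 1) (reverse xs)
reverse-rotate₁ []       = refl
reverse-rotate₁ (x ∷ xs) = begin
  reverse (xs ++ [ x ])                       ≡⟨ reverse-++ xs [ x ] ⟩
  x ∷ reverse xs                              ≡⟨ rotate-++ (reverse xs) [ x ] ⟨
  rotate (length (reverse xs)) (xs′ ++ [ x ]) ≡⟨ cong (λ l → rotate l (xs′ ++ [ x ])) (length-reverse xs) ⟩
  rotate (length xs) (xs′ ++ [ x ])           ≡⟨ cong (rotate (length xs)) (unfold-reverse x xs) ⟨
  rotate (length xs) (reverse (x ∷ xs))       ∎
  where xs′ = reverse xs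

reverse-rotate : ∀ k (xs : BStr) → reverse (rotate k xs) ≡ rotate (k * (length xs ∸ 1)) (reverse xs)
reverse-rotate zero    xs = refl
reverse-rotate (suc k) xs = begin
  reverse (rotate (suc k) xs)
    ≡⟨ cong reverse (rotate-+ 1 k xs) ⟩
  reverse (rotate k (rotate 1 xs))
    ≡⟨ reverse-rotate k (rotate 1 xs) ⟩
  rotate (k * (length (rotate 1 xs) ∸ 1)) (reverse (rotate 1 xs))
    ≡⟨ cong (λ m → rotate (k * (m ∸ 1)) (reverse (rotate 1 xs))) (length-rotate 1 xs) ⟩
  rotate (k * (l ∸ 1)) (reverse (rotate 1 xs))
    ≡⟨ cong (rotate (k * (l ∸ 1))) (reverse-rotate₁ xs) ⟩
  rotate (k * (l ∸ 1)) (rotate (l ∸ 1) (reverse xs))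
    ≡⟨ rotate-+ (l ∸ 1) (k * (l ∸ 1)) (reverse xs) ⟨
  rotate (suc k * (l ∸ 1)) (reverse xs)
    ∎
  where
  l = length xs

-- Rotation by any amount; InRotations additionally bounds the amount by the length.
infix 4 _∼_
_∼_ : BStr → BStr → Set
y ∼ x = ∃[ k ] y ≡ rotate k x

∼-refl : ∀ {x} → x ∼ x
∼-refl = 0 , refl

∼-reflexive : ∀ {x y} → y ≡ x → y ∼ x
∼-reflexive y≡x = 0 , y≡x

∼-trans : ∀ {z y x} → z ∼ y → y ∼ x → z ∼ x
∼-trans {x = x} (k , refl) (l , refl) = l + k , sym (rotate-+ l k x)

∼-sym : ∀ {y x} → y ∼ x → x ∼ y
∼-sym {x = []}     (k , refl) = 0 , sym (rotate-[] k)
∼-sym {x = a ∷ as} (k , refl) = k * length as , sym (begin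
  rotate (k * length as) (rotate k (a ∷ as))    ≡⟨ rotate-+ k (k * length as) (a ∷ as) ⟨
  rotate (k + k * length as) (a ∷ as)           ≡⟨ cong (λ m → rotate m (a ∷ as)) (*-suc k (length as)) ⟨
  rotate (k * length (a ∷ as)) (a ∷ as)         ≡⟨ rotate-*-length k (a ∷ as) ⟩
  a ∷ as                                        ∎)

∼-reverse : ∀ {y x} → y ∼ x → reverse y ∼ reverse x
∼-reverse {x = x} (k , refl) = k * (length x ∸ 1) , reverse-rotate k x

++-comm-∼ : ∀ (xs ys : BStr) → ys ++ xs ∼ xs ++ ys
++-comm-∼ xs ys = length xs , sym (rotate-++ xs ys)

∼-length : ∀ {y x} → y ∼ x → length y ≡ length x
∼-length {x = x} (k , refl) = length-rotate k x

∼⇒InRotations : ∀ {y x} → y ∼ x → 0 < length x → InRotations y x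
∼⇒InRotations {x = a ∷ as} (k , refl) _ = k % L , m%n<n k L , (begin
  rotate k x                                 ≡⟨ cong (λ m → rotate m x) (m≡m%n+[m/n]*n k L) ⟩
  rotate (k % L + k / L * L) x               ≡⟨ rotate-+ (k % L) (k / L * L) x ⟩
  rotate (k / L * L) y                       ≡⟨ cong (λ m → rotate (k / L * m) y) (length-rotate (k % L) x) ⟨
  rotate (k / L * length y) y                ≡⟨ rotate-*-length (k / L) y ⟩
  y                                          ∎)
  where
  x = a ∷ as
  L = length x
  y = rotate (k % L) x

neckAux-∼ : ∀ k xs best → best ∼ xs → neckAux k xs best ∼ xs
neckAux-∼ zero    xs best best∼xs = best∼xs
neckAux-∼ (suc k) xs best best∼xs with leq (rotate k xs) best
... | true  = neckAux-∼ k xs (rotate k xs) (k , refl)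
... | false = neckAux-∼ k xs best best∼xs

neck-∼ : ∀ xs → neck xs ∼ xs
neck-∼ xs = neckAux-∼ (length xs) xs xs ∼-refl

-- Lexicographic order

leq-refl : ∀ xs → leq xs xs ≡ true
leq-refl []       = refl
leq-refl (O ∷ xs) = leq-refl xs
leq-refl (I ∷ xs) = leq-refl xs

leq-false⇒leq-flip : ∀ xs ys → leq xs ys ≡ false → leq ys xs ≡ true
leq-false⇒leq-flip (x ∷ xs) []       _ = refl
leq-false⇒leq-flip (O ∷ xs) (O ∷ ys) p = leq-false⇒leq-flip xs ys p
leq-false⇒leq-flip (I ∷ xs) (O ∷ ys) _ = refl
leq-false⇒leq-flip (I ∷ xs) (I ∷ ys) p = leq-false⇒leq-flip xs ys p

leq-++-cancelˡ : ∀ ps xs ys → leq (ps ++ xs) (ps ++ ys) ≡ leq xs ys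
leq-++-cancelˡ []       xs ys = refl
leq-++-cancelˡ (O ∷ ps) xs ys = leq-++-cancelˡ ps xs ys
leq-++-cancelˡ (I ∷ ps) xs ys = leq-++-cancelˡ ps xs ys

zeros-split : ∀ {j r} → j < r → ∀ xs → ∃[ d ] zeros r ++ xs ≡ zeros j ++ O ∷ zeros d ++ xs
zeros-split {j} j<r xs with <⇒≡+suc j<r
... | d , refl = d , trans (cong (_++ xs) (replicate-+ j (suc d) false)) (++-assoc (zeros j) _ xs)

leq-moreLeadingZeros : ∀ {j r} → j < r → ∀ xs ys → leq (zeros r ++ xs) (zeros j ++ I ∷ ys) ≡ true
leq-moreLeadingZeros {j} j<r xs ys with zeros-split j<r xs
... | d , eq = trans (cong (λ l → leq l (zeros j ++ I ∷ ys)) eq) (leq-++-cancelˡ (zeros j) _ (I ∷ ys))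

leq-fewerLeadingZeros : ∀ {j r} → j < r → ∀ xs ys → leq (zeros j ++ I ∷ ys) (zeros r ++ xs) ≡ false
leq-fewerLeadingZeros {j} j<r xs ys with zeros-split j<r xs
... | d , eq = trans (cong (leq (zeros j ++ I ∷ ys)) eq) (leq-++-cancelˡ (zeros j) (I ∷ ys) _)

-- Strings outside A(n)

0<length : ∀ {n} (y : BStr) → length y ≡ suc n → 0 < length y
0<length y len = subst (0 <_) (sym len) (s≤s z≤n)

symmetric-∉A : ∀ {n y x} → y ∼ x → reverse x ∼ x → ¬ InA (suc n) y
symmetric-∉A {y = y} y∼x rx∼x (len , _ , asymmetric) =
  asymmetric (∼⇒InRotations (∼-trans (∼-reverse y∼x) (∼-trans rx∼x (∼-sym y∼x))) (0<length y len))

swap-symmetric-∉A : ∀ {n y} xs ys → y ∼ xs ++ ys → reverse (xs ++ ys) ≡ ys ++ xs → ¬ InA (suc n) y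
swap-symmetric-∉A xs ys y∼ rev = symmetric-∉A y∼ (subst (_∼ xs ++ ys) (sym rev) (++-comm-∼ xs ys))

blocks-∉A : ∀ {n y} m j → y ∼ zeros m ++ ones j → ¬ InA (suc n) y
blocks-∉A m j y∼ = swap-symmetric-∉A (zeros m) (ones j) y∼
  (trans (reverse-replicate-++ m false (ones j)) (cong (_++ zeros m) (reverse-replicate j true)))

smallerReversal-∉A : ∀ {n y β} → β ∼ reverse y → leq y β ≡ false → ¬ InA (suc n) y
smallerReversal-∉A {y = y} {β} β∼ry y≰β (len , bracelet , _)
  with trans (sym (proj₂ (bracelet β) (∼⇒InRotations β∼ry 0<))) y≰β
  where 0< = subst (0 <_) (sym (length-reverse y)) (0<length y len)
... | ()

-- neck x is a rotation of x, so it lies strictly above z, a rotation of its reversal.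
neck-∉A : ∀ {n} x z → z ∼ reverse x → (∀ j → j < length x → leq (rotate j x) z ≡ false) →
          ¬ InA (suc n) (neck x)
neck-∉A x z z∼rx below ia@(len , _)
  with ∼⇒InRotations (neck-∼ x) (subst (0 <_) (∼-length (neck-∼ x)) (0<length (neck x) len))
... | j , j< , neck≡ = smallerReversal-∉A (∼-trans z∼rx (∼-reverse (∼-sym (neck-∼ x))))
                         (subst (λ y → leq y z ≡ false) (sym neck≡) (below j j<)) ia

-- Rotations starting inside the block of ones begin with 1, so they lie above O ∷ z.
rotations-above : ∀ (p q z : BStr) m →
  (∀ j → j < length p → leq (rotate j (p ++ ones m ++ q)) (O ∷ z) ≡ false) →
  (∀ t → t < length q → leq (rotate t (q ++ p ++ ones m)) (O ∷ z) ≡ false) →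
  ∀ j → j < length (p ++ ones m ++ q) → leq (rotate j (p ++ ones m ++ q)) (O ∷ z) ≡ false
rotations-above p q z m inP inQ j j< with <⊎≡+ j (length p)
... | inj₁ j<p = inP j j<p
... | inj₂ (i , refl) = trans (cong (λ l → leq l (O ∷ z)) rotate-p) (fromBlock i i<m+q)
  where
  rotate-p : rotate (length p + i) (p ++ ones m ++ q) ≡ rotate i (ones m ++ q ++ p)
  rotate-p = trans (rotate-++-+ p (ones m ++ q) i) (cong (rotate i) (++-assoc (ones m) q p))

  i<m+q : i < m + length q
  i<m+q = +-cancelˡ-< (length p) i _
    (subst (length p + i <_) (trans (length-++ p) (cong (length p +_) (length-replicate-++ m true q))) j<)

  fromBlock : ∀ i → i < m + length q → leq (rotate i (ones m ++ q ++ p)) (O ∷ z) ≡ false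
  fromBlock i i<m+q with <⊎≡+ i m
  ... | inj₁ i<m with rotate-replicate-< i<m true (q ++ p)
  ...   | _ , _ , eq = cong (λ l → leq l (O ∷ z)) eq
  fromBlock i i<m+q | inj₂ (t , refl) =
    trans (cong (λ l → leq l (O ∷ z)) rotate-ones) (inQ t (+-cancelˡ-< m t _ i<m+q))
    where
    rotate-ones : rotate (m + t) (ones m ++ q ++ p) ≡ rotate t (q ++ p ++ ones m)
    rotate-ones = trans (cong (λ l → rotate (l + t) (ones m ++ q ++ p)) (sym (length-replicate m)))
                        (trans (rotate-++-+ (ones m) (q ++ p) t) (cong (rotate t) (++-assoc q p (ones m))))

-- Strings inside A(n)

leadingZeros< : ℕ → BStr → Bool
leadingZeros< zero    _        = false
leadingZeros< (suc r) []       = false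
leadingZeros< (suc r) (I ∷ _)  = true
leadingZeros< (suc r) (O ∷ xs) = leadingZeros< r xs

allSuffixes : (BStr → Bool) → BStr → Bool
allSuffixes P []       = true
allSuffixes P (x ∷ xs) = P (x ∷ xs) ∧ allSuffixes P xs

leadingZeros<-shape : ∀ r xs → leadingZeros< r xs ≡ true →
                      ∀ ys → ∃₂ λ j zs → j < r × xs ++ ys ≡ zeros j ++ I ∷ zs
leadingZeros<-shape (suc r) (I ∷ xs) _  ys = 0 , xs ++ ys , s≤s z≤n , refl
leadingZeros<-shape (suc r) (O ∷ xs) lz ys with leadingZeros<-shape r xs lz ys
... | j , zs , j<r , eq = suc j , zs , s≤s j<r , cong (O ∷_) eq

allSuffixes-drop : ∀ P xs i → allSuffixes P xs ≡ true → i < length xs → P (drop i xs) ≡ true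
allSuffixes-drop P (x ∷ xs) zero    all _        with P (x ∷ xs)
... | true = refl
allSuffixes-drop P (x ∷ xs) (suc i) all (s≤s i<) with P (x ∷ xs)
... | true = allSuffixes-drop P xs i all i<

allSuffixes-ones : ∀ r m xs →
  allSuffixes (leadingZeros< (suc r)) (ones m ++ xs) ≡ allSuffixes (leadingZeros< (suc r)) xs
allSuffixes-ones r zero    xs = refl
allSuffixes-ones r (suc m) xs = allSuffixes-ones r m xs

allSuffixes-ones-[] : ∀ r m → allSuffixes (leadingZeros< (suc r)) (ones m) ≡ true
allSuffixes-ones-[] r zero    = refl
allSuffixes-ones-[] r (suc m) = allSuffixes-ones-[] r m

rotate-leadingZeros< : ∀ r xs i → allSuffixes (leadingZeros< r) xs ≡ true → i < length xs →
                       ∃₂ λ j zs → j < r × rotate i (xs ++ zeros r) ≡ zeros j ++ I ∷ zs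
rotate-leadingZeros< r xs i all i<
  with leadingZeros<-shape r (drop i xs) (allSuffixes-drop _ xs i all i<) (zeros r ++ take i xs)
... | j , zs , j<r , eq = j , zs , j<r , trans (rotate-drop-take i xs (zeros r) (<⇒≤ i<)) eq

-- Apart from 0ʳw itself and 0ʳ(reverse w), every rotation of 0ʳw or of its reversal
-- starts with fewer than r zeros.
module _ {r : ℕ} {u u′ : BStr}
  (suffixes  : allSuffixes (leadingZeros< r) (I ∷ u) ≡ true)
  (suffixesʳ : allSuffixes (leadingZeros< r) (I ∷ u′) ≡ true)
  (reverse-u : reverse (I ∷ u) ≡ I ∷ u′)
  (reverse-greater : leq (I ∷ u′) (I ∷ u) ≡ false) where

  private
    w w′ α : BStr
    w  = I ∷ u
    w′ = I ∷ u′
    α  = zeros r ++ w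

  zeroBlock-minimal : ∀ k → k < length α → leq α (rotate k α) ≡ true
  zeroBlock-minimal k k< with <⊎≡+ k r
  ... | inj₁ k<r = inBlock k k<r
    where
    inBlock : ∀ k → k < r → leq α (rotate k α) ≡ true
    inBlock zero    _   = leq-refl α
    inBlock (suc k) k<r with rotate-zeros (s≤s z≤n) k<r w
    ... | d , d<r , eq = trans (cong (leq α) eq) (leq-moreLeadingZeros d<r w (u ++ zeros (suc k)))
  ... | inj₂ (i , refl)
    with rotate-leadingZeros< r w i suffixes
           (+-cancelˡ-< r i (length w) (subst (r + i <_) (length-replicate-++ r false w) k<))
  ...   | j , zs , j<r , eq =
    trans (cong (leq α) (trans rotate-α eq)) (leq-moreLeadingZeros j<r w zs)
    where
    rotate-α : rotate (r + i) α ≡ rotate i (w ++ zeros r)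
    rotate-α = trans (cong (λ l → rotate (l + i) α) (sym (length-replicate r))) (rotate-++-+ (zeros r) w i)

  reverse-α : reverse α ≡ w′ ++ zeros r
  reverse-α = trans (reverse-replicate-++ r false w) (cong (_++ zeros r) reverse-u)

  zeroBlock-reversal-greater : ∀ k → k < length w′ + r → leq (rotate k (w′ ++ zeros r)) α ≡ false
  zeroBlock-reversal-greater k k< with <⊎≡+ k (length w′)
  ... | inj₁ k<w′ with rotate-leadingZeros< r w′ k suffixesʳ k<w′
  ...   | j , zs , j<r , eq = trans (cong (λ l → leq l α) eq) (leq-fewerLeadingZeros j<r w zs)
  zeroBlock-reversal-greater k k< | inj₂ (i , refl) =
    trans (cong (λ l → leq l α) (rotate-++-+ w′ (zeros r) i)) (inBlock i (+-cancelˡ-< (length w′) i r k<))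
    where
    inBlock : ∀ i → i < r → leq (rotate i (zeros r ++ w′)) α ≡ false
    inBlock zero    _   = trans (leq-++-cancelˡ (zeros r) w′ w) reverse-greater
    inBlock (suc i) i<r with rotate-zeros (s≤s z≤n) i<r w′
    ... | d , d<r , eq = trans (cong (λ l → leq l α) eq) (leq-fewerLeadingZeros d<r w (u′ ++ zeros (suc i)))

  zeroBlock-∈A : ∀ {n} → length α ≡ n → InA n α
  zeroBlock-∈A refl = refl , (λ β → minimal β , reversal β) , asymmetric
    where
    length-reverse-α : length (reverse α) ≡ length w′ + r
    length-reverse-α =
      trans (cong length reverse-α) (trans (length-++ w′) (cong (length w′ +_) (length-replicate r)))

    reversal-greater : ∀ k → k < length α → leq (rotate k (reverse α)) α ≡ false
    reversal-greater k k< = subst (λ l → leq (rotate k l) α ≡ false) (sym reverse-α)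
      (zeroBlock-reversal-greater k (subst (k <_) (trans (sym (length-reverse α)) length-reverse-α) k<))

    minimal : ∀ β → InRotations β α → α ≤L β
    minimal β (k , k< , refl) = zeroBlock-minimal k k<

    reversal : ∀ β → InRotations β (reverse α) → α ≤L β
    reversal β (k , k< , refl) =
      leq-false⇒leq-flip (rotate k (reverse α)) α (reversal-greater k (subst (k <_) (length-reverse α) k<))

    asymmetric : ¬ IsSymmetric α
    asymmetric (k , _ , rev≡)
      with ∼⇒InRotations (∼-sym (k , rev≡)) (subst (0 <_) (sym length-reverse-α) (s≤s z≤n))
    ... | j , j< , α≡ with trans (sym (leq-refl α))
                             (trans (cong (λ l → leq l α) α≡)
                                    (reversal-greater j (subst (j <_) (length-reverse α) j<)))
    ...   | ()

flipFirstOne-zeros : ∀ m xs → flipFirstOne (zeros m ++ xs) ≡ zeros m ++ flipFirstOne xs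
flipFirstOne-zeros zero    xs = refl
flipFirstOne-zeros (suc m) xs = cong (O ∷_) (flipFirstOne-zeros m xs)

flipFirstZero-ones : ∀ m xs → flipFirstZero (ones m ++ xs) ≡ ones m ++ flipFirstZero xs
flipFirstZero-ones zero    xs = refl
flipFirstZero-ones (suc m) xs = cong (I ∷_) (flipFirstZero-ones m xs)

lastTo0-++ : ∀ xs x ys → lastTo0 (xs ++ x ∷ ys) ≡ xs ++ lastTo0 (x ∷ ys)
lastTo0-++ []           x ys = refl
lastTo0-++ (a ∷ [])     x ys = refl
lastTo0-++ (a ∷ b ∷ xs) x ys = cong (a ∷_) (lastTo0-++ (b ∷ xs) x ys)

-- The witnesses

module _ (k : ℕ) where

  onlyFirstZero onlyLastOne onlyLastZero noLastOp noZeroOp noFirstZeroLastOne : BStr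
  onlyFirstZero      = zeros (6 + k) ++ I ∷ O ∷ I ∷ I ∷ []
  onlyLastOne        = O ∷ O ∷ I ∷ O ∷ ones (6 + k)
  onlyLastZero       = O ∷ O ∷ I ∷ O ∷ ones (3 + k) ++ O ∷ I ∷ I ∷ []
  noLastOp           = zeros (4 + k) ++ I ∷ I ∷ O ∷ I ∷ I ∷ I ∷ []
  noZeroOp           = O ∷ O ∷ I ∷ I ∷ O ∷ ones (5 + k)
  noFirstZeroLastOne = O ∷ O ∷ I ∷ O ∷ ones (1 + k) ++ O ∷ I ∷ O ∷ I ∷ I ∷ []

  onlyFirstZero-∈A : InA (10 + k) onlyFirstZero
  onlyFirstZero-∈A = zeroBlock-∈A {6 + k} refl refl refl refl
    (trans (length-replicate-++ (6 + k) false _) (cong (6 +_) (+-comm k 4)))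

  onlyFirstZero-FirstOne-∉A : ¬ InA (10 + k) (FirstOne onlyFirstZero)
  onlyFirstZero-FirstOne-∉A = blocks-∉A (8 + k) 2
    (∼-reflexive (trans (flipFirstOne-zeros (6 + k) _) (replicate-++-swap (6 + k) 2 false (ones 2))))

  onlyFirstZero-LastOne-∉A : ¬ InA (10 + k) (LastOne onlyFirstZero)
  onlyFirstZero-LastOne-∉A = swap-symmetric-∉A (zeros (5 + k)) (O ∷ I ∷ O ∷ I ∷ O ∷ [])
    (∼-trans (neck-∼ _) (∼-reflexive (trans (lastTo0-++ (zeros (6 + k)) I _) (sym (replicate-∷ʳ (5 + k) O _)))))
    (reverse-replicate-++ (5 + k) O _)

  onlyFirstZero-LastZero-∉A : ¬ InA (10 + k) (LastZero onlyFirstZero)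
  onlyFirstZero-LastZero-∉A = blocks-∉A (6 + k) 4 (∼-reflexive (begin
    reverse (flipFirstZero (reverse onlyFirstZero))
      ≡⟨ cong (reverse ∘ flipFirstZero) (reverse-replicate-++ (6 + k) O (I ∷ O ∷ I ∷ I ∷ [])) ⟩
    reverse (I ∷ I ∷ I ∷ I ∷ zeros (6 + k))
      ≡⟨ reverse-++-replicate (6 + k) O (ones 4) ⟩
    zeros (6 + k) ++ ones 4
      ∎))

  onlyLastOne-∈A : InA (10 + k) onlyLastOne
  onlyLastOne-∈A = zeroBlock-∈A {2} (allSuffixes-ones-[] 1 (6 + k)) (allSuffixes-ones 1 (5 + k) _)
    (reverse-++-replicate (6 + k) I (I ∷ O ∷ [])) refl (cong (4 +_) (length-replicate (6 + k)))

  onlyLastOne-FirstOne-∉A : ¬ InA (10 + k) (FirstOne onlyLastOne)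
  onlyLastOne-FirstOne-∉A = blocks-∉A 4 (6 + k) ∼-refl

  onlyLastOne-FirstZero-∉A : ¬ InA (10 + k) (FirstZero onlyLastOne)
  onlyLastOne-FirstZero-∉A = swap-symmetric-∉A (I ∷ O ∷ I ∷ O ∷ I ∷ []) (ones (5 + k))
    (neck-∼ _) (reverse-++-replicate (5 + k) I (I ∷ O ∷ I ∷ O ∷ I ∷ []))

  onlyLastOne-LastZero-∉A : ¬ InA (10 + k) (LastZero onlyLastOne)
  onlyLastOne-LastZero-∉A = blocks-∉A 2 (8 + k) (∼-reflexive (begin
    reverse (flipFirstZero (reverse onlyLastOne))
      ≡⟨ cong (reverse ∘ flipFirstZero) (reverse-++-replicate (6 + k) I (O ∷ O ∷ I ∷ O ∷ [])) ⟩
    reverse (flipFirstZero (ones (6 + k) ++ O ∷ I ∷ O ∷ O ∷ []))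
      ≡⟨ cong reverse (flipFirstZero-ones (6 + k) (O ∷ I ∷ O ∷ O ∷ [])) ⟩
    reverse (ones (6 + k) ++ I ∷ I ∷ O ∷ O ∷ [])
      ≡⟨ reverse-replicate-++ (6 + k) I (I ∷ I ∷ O ∷ O ∷ []) ⟩
    zeros 2 ++ ones (8 + k)
      ∎))

  onlyLastZero-∈A : InA (10 + k) onlyLastZero
  onlyLastZero-∈A = zeroBlock-∈A {2} (allSuffixes-ones 1 k _) (allSuffixes-ones 1 k _)
    (reverse-++-replicate-++ (I ∷ O ∷ []) (3 + k) I (O ∷ I ∷ I ∷ [])) refl
    (cong (4 +_) (trans (length-replicate-++ (3 + k) I _) (cong (3 +_) (+-comm k 3))))

  onlyLastZero-FirstOne-∉A : ¬ InA (10 + k) (FirstOne onlyLastZero)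
  onlyLastZero-FirstOne-∉A = smallerReversal-∉A
    (subst (zeros 4 ++ I ∷ I ∷ O ∷ ones (3 + k) ∼_)
           (sym (reverse-++-replicate-++ (zeros 4) (3 + k) I (O ∷ I ∷ I ∷ [])))
           (++-comm-∼ (I ∷ I ∷ O ∷ ones (3 + k)) (zeros 4)))
    refl

  onlyLastZero-LastOne-∉A : ¬ InA (10 + k) (LastOne onlyLastZero)
  onlyLastZero-LastOne-∉A = swap-symmetric-∉A (O ∷ []) (O ∷ I ∷ O ∷ ones (3 + k) ++ O ∷ I ∷ O ∷ [])
    (∼-trans (neck-∼ _) (∼-reflexive (lastTo0-++ (O ∷ O ∷ I ∷ O ∷ ones (3 + k)) O (I ∷ I ∷ []))))
    (trans (reverse-++-replicate-++ (O ∷ O ∷ I ∷ O ∷ []) (3 + k) I (O ∷ I ∷ O ∷ []))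
           (cong (λ l → O ∷ I ∷ O ∷ l) (sym (++-assoc (ones (3 + k)) (O ∷ I ∷ O ∷ []) (O ∷ [])))))

  noLastOp-∈A : InA (10 + k) noLastOp
  noLastOp-∈A = zeroBlock-∈A {4 + k} refl refl refl refl
    (trans (length-replicate-++ (4 + k) O _) (cong (4 +_) (+-comm k 6)))

  noLastOp-LastOne-∉A : ¬ InA (10 + k) (LastOne noLastOp)
  noLastOp-LastOne-∉A = swap-symmetric-∉A (zeros (3 + k)) (O ∷ I ∷ I ∷ O ∷ I ∷ I ∷ O ∷ [])
    (∼-trans (neck-∼ _) (∼-reflexive (trans (lastTo0-++ (zeros (4 + k)) I _) (sym (replicate-∷ʳ (3 + k) O _)))))
    (reverse-replicate-++ (3 + k) O _)

  noLastOp-LastZero-∉A : ¬ InA (10 + k) (LastZero noLastOp)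
  noLastOp-LastZero-∉A = blocks-∉A (4 + k) 6 (∼-reflexive (begin
    reverse (flipFirstZero (reverse noLastOp))
      ≡⟨ cong (reverse ∘ flipFirstZero) (reverse-replicate-++ (4 + k) O (I ∷ I ∷ O ∷ I ∷ I ∷ I ∷ [])) ⟩
    reverse (ones 6 ++ zeros (4 + k))
      ≡⟨ reverse-++-replicate (4 + k) O (ones 6) ⟩
    zeros (4 + k) ++ ones 6
      ∎))

  noZeroOp-∈A : InA (10 + k) noZeroOp
  noZeroOp-∈A = zeroBlock-∈A {2} (allSuffixes-ones-[] 1 (5 + k)) (allSuffixes-ones 1 (4 + k) _)
    (reverse-++-replicate (5 + k) I (I ∷ I ∷ O ∷ [])) refl (cong (5 +_) (length-replicate (5 + k)))

  noZeroOp-FirstZero-∉A : ¬ InA (10 + k) (FirstZero noZeroOp)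
  noZeroOp-FirstZero-∉A = swap-symmetric-∉A (I ∷ O ∷ I ∷ I ∷ O ∷ I ∷ []) (ones (4 + k))
    (neck-∼ _) (reverse-++-replicate (4 + k) I (I ∷ O ∷ I ∷ I ∷ O ∷ I ∷ []))

  noZeroOp-LastZero-∉A : ¬ InA (10 + k) (LastZero noZeroOp)
  noZeroOp-LastZero-∉A = blocks-∉A 2 (8 + k) (∼-reflexive (begin
    reverse (flipFirstZero (reverse noZeroOp))
      ≡⟨ cong (reverse ∘ flipFirstZero) (reverse-++-replicate (5 + k) I (O ∷ O ∷ I ∷ I ∷ O ∷ [])) ⟩
    reverse (flipFirstZero (ones (5 + k) ++ O ∷ I ∷ I ∷ O ∷ O ∷ []))
      ≡⟨ cong reverse (flipFirstZero-ones (5 + k) (O ∷ I ∷ I ∷ O ∷ O ∷ [])) ⟩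
    reverse (ones (5 + k) ++ I ∷ I ∷ I ∷ O ∷ O ∷ [])
      ≡⟨ reverse-replicate-++ (5 + k) I (I ∷ I ∷ I ∷ O ∷ O ∷ []) ⟩
    zeros 2 ++ ones (8 + k)
      ∎))

  noFirstZeroLastOne-∈A : InA (10 + k) noFirstZeroLastOne
  noFirstZeroLastOne-∈A = zeroBlock-∈A {2} (allSuffixes-ones 1 k _) (allSuffixes-ones 1 k _)
    (reverse-++-replicate-++ (I ∷ O ∷ []) (1 + k) I (O ∷ I ∷ O ∷ I ∷ I ∷ [])) refl
    (cong (4 +_) (trans (length-replicate-++ (1 + k) I _) (cong (1 +_) (+-comm k 5))))

  noFirstZeroLastOne-FirstZero-∉A : ¬ InA (10 + k) (FirstZero noFirstZeroLastOne)
  noFirstZeroLastOne-FirstZero-∉A = symmetric-∉A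
    (∼-trans (neck-∼ _) (∼-reflexive (cong (λ l → I ∷ O ∷ I ∷ O ∷ l) (sym (++-assoc (ones (1 + k)) s [ I ])))))
    (subst (_∼ x) (sym (reverse-++ (p ++ ones (1 + k) ++ s) [ I ]))
           (subst (λ l → I ∷ l ∼ x) (sym (reverse-++-replicate-++ p (1 + k) I s)) (++-comm-∼ _ [ I ])))
    where
    p s x : BStr
    p = I ∷ O ∷ I ∷ O ∷ []
    s = O ∷ I ∷ O ∷ I ∷ []
    x = (p ++ ones (1 + k) ++ s) ++ [ I ]

  onlyLastOne≢onlyFirstZero : onlyLastOne ≢ onlyFirstZero
  onlyLastOne≢onlyFirstZero ()

  onlyLastZero≢onlyFirstZero : onlyLastZero ≢ onlyFirstZero
  onlyLastZero≢onlyFirstZero ()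

  noZeroOp≢onlyLastOne : noZeroOp ≢ onlyLastOne
  noZeroOp≢onlyLastOne ()

  noLastOp≢onlyFirstZero : noLastOp ≢ onlyFirstZero
  noLastOp≢onlyFirstZero =
    reverse-≢ (reverse-replicate-++ (4 + k) O _) (reverse-replicate-++ (6 + k) O _) (λ ())

  onlyLastZero≢onlyLastOne : onlyLastZero ≢ onlyLastOne
  onlyLastZero≢onlyLastOne =
    reverse-≢ (reverse-++-replicate-++ (O ∷ O ∷ I ∷ O ∷ []) (3 + k) I _)
              (reverse-++-replicate (6 + k) I (O ∷ O ∷ I ∷ O ∷ [])) (λ ())

  noFirstZeroLastOne≢onlyLastZero : noFirstZeroLastOne ≢ onlyLastZero
  noFirstZeroLastOne≢onlyLastZero =
    reverse-≢ (reverse-++-replicate-++ (O ∷ O ∷ I ∷ O ∷ []) (1 + k) I _)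
              (reverse-++-replicate-++ (O ∷ O ∷ I ∷ O ∷ []) (3 + k) I _) (λ ())

onlyLastZero-FirstZero-∉A : ∀ k → ¬ InA (10 + k) (FirstZero (onlyLastZero k))
onlyLastZero-FirstZero-∉A zero     = symmetric-∉A (neck-∼ (firstTo1 (onlyLastZero 0))) (5 , refl)
onlyLastZero-FirstZero-∉A (suc k′) = neck-∉A x (O ∷ z) z∼reverse-x
  (rotations-above p q z (4 + k′)
    (λ { 0 _ → refl ; 1 _ → refl ; 2 _ → refl ; 3 _ → refl
       ; (suc (suc (suc (suc _)))) (s≤s (s≤s (s≤s (s≤s ())))) })
    (λ { 0 _ → refl ; 1 _ → refl ; 2 _ → refl
       ; (suc (suc (suc _))) (s≤s (s≤s (s≤s ()))) }))
  where
  p q x z : BStr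
  p = I ∷ O ∷ I ∷ O ∷ []
  q = O ∷ I ∷ I ∷ []
  x = p ++ ones (4 + k′) ++ q
  z = I ∷ O ∷ I ∷ I ∷ I ∷ O ∷ ones (4 + k′)

  z∼reverse-x : O ∷ z ∼ reverse x
  z∼reverse-x = subst (O ∷ z ∼_) (sym (reverse-++-replicate-++ p (4 + k′) I q))
                      (++-comm-∼ (I ∷ I ∷ O ∷ ones (4 + k′)) (O ∷ I ∷ O ∷ I ∷ []))

noFirstZeroLastOne-LastOne-∉A : ∀ k → ¬ InA (10 + k) (LastOne (noFirstZeroLastOne k))
noFirstZeroLastOne-LastOne-∉A zero     = symmetric-∉A (neck-∼ (lastTo0 (noFirstZeroLastOne 0))) (1 , refl)
noFirstZeroLastOne-LastOne-∉A (suc k′) =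
  subst (λ y → ¬ InA (11 + k′) (neck y)) (sym (lastTo0-++ (p ++ ones (2 + k′)) O (I ∷ O ∷ I ∷ I ∷ [])))
    (neck-∉A x (O ∷ z) z∼reverse-x
      (rotations-above p q z (2 + k′)
        (λ { 0 _ → refl ; 1 _ → refl ; 2 _ → refl ; 3 _ → refl
           ; (suc (suc (suc (suc _)))) (s≤s (s≤s (s≤s (s≤s ())))) })
        (λ { 0 _ → refl ; 1 _ → refl ; 2 _ → refl ; 3 _ → refl ; 4 _ → refl
           ; (suc (suc (suc (suc (suc _))))) (s≤s (s≤s (s≤s (s≤s (s≤s ()))))) })))
  where
  p q r x z : BStr
  p = O ∷ O ∷ I ∷ O ∷ []
  q = O ∷ I ∷ O ∷ I ∷ O ∷ []
  r = q ++ ones (2 + k′) ++ O ∷ I ∷ []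
  x = p ++ ones (2 + k′) ++ q
  z = O ∷ r

  z∼reverse-x : O ∷ z ∼ reverse x
  z∼reverse-x = subst (O ∷ z ∼_)
    (sym (trans (reverse-++-replicate-++ p (2 + k′) I q)
                (cong (q ++_) (sym (++-assoc (ones (2 + k′)) (O ∷ I ∷ []) (O ∷ O ∷ []))))))
    (++-comm-∼ r (O ∷ O ∷ []))

module _ (k : ℕ) where

  onlyFirstZero-keeps : ∀ o → InA (10 + k) (apply o (onlyFirstZero k)) → o ≡ firstZero
  onlyFirstZero-keeps firstOne  ∈A = ⊥-elim (onlyFirstZero-FirstOne-∉A k ∈A)
  onlyFirstZero-keeps lastOne   ∈A = ⊥-elim (onlyFirstZero-LastOne-∉A k ∈A)
  onlyFirstZero-keeps firstZero _  = refl
  onlyFirstZero-keeps lastZero  ∈A = ⊥-elim (onlyFirstZero-LastZero-∉A k ∈A)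

  onlyLastOne-keeps : ∀ o → InA (10 + k) (apply o (onlyLastOne k)) → o ≡ lastOne
  onlyLastOne-keeps firstOne  ∈A = ⊥-elim (onlyLastOne-FirstOne-∉A k ∈A)
  onlyLastOne-keeps lastOne   _  = refl
  onlyLastOne-keeps firstZero ∈A = ⊥-elim (onlyLastOne-FirstZero-∉A k ∈A)
  onlyLastOne-keeps lastZero  ∈A = ⊥-elim (onlyLastOne-LastZero-∉A k ∈A)

  onlyLastZero-keeps : ∀ o → InA (10 + k) (apply o (onlyLastZero k)) → o ≡ lastZero
  onlyLastZero-keeps firstOne  ∈A = ⊥-elim (onlyLastZero-FirstOne-∉A k ∈A)
  onlyLastZero-keeps lastOne   ∈A = ⊥-elim (onlyLastZero-LastOne-∉A k ∈A)
  onlyLastZero-keeps firstZero ∈A = ⊥-elim (onlyLastZero-FirstZero-∉A k ∈A)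
  onlyLastZero-keeps lastZero  _  = refl

-- Operation trees

NonRoot : ℕ → BStr → BStr → Set
NonRoot n ρ α = InA n α × α ≢ ρ

Distinct₃ : Op → Op → Op → Set
Distinct₃ x y z = x ≢ y × x ≢ z × y ≢ z

distinct₃ : ∀ {x y z X Y : Op} → x ≡ X → y ≡ Y → X ≢ Y → z ≢ X → z ≢ Y → Distinct₃ x y z
distinct₃ refl refl X≢Y z≢X z≢Y = X≢Y , (λ x≡z → z≢X (sym x≡z)) , (λ y≡z → z≢Y (sym y≡z))

ThreeOps : ℕ → BStr → (BStr → Op) → Set
ThreeOps n ρ op = ∃[ α ] ∃[ β ] ∃[ γ ]
  (NonRoot n ρ α × NonRoot n ρ β × NonRoot n ρ γ × Distinct₃ (op α) (op β) (op γ))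

module _ {n ρ op} (T : IsOpTree n ρ op) where
  open IsOpTree T

  parentOp-avoids : ∀ {α} → NonRoot n ρ α → ∀ o → ¬ InA n (apply o α) → op α ≢ o
  parentOp-avoids {α} (α∈A , α≢ρ) o ∉A op≡o =
    ∉A (subst (λ o′ → InA n (apply o′ α)) op≡o (parent∈A α α∈A α≢ρ))

  parentOp-forced : ∀ {α} → NonRoot n ρ α → ∀ o → (∀ o′ → InA n (apply o′ α) → o′ ≡ o) → op α ≡ o
  parentOp-forced {α} (α∈A , α≢ρ) o keeps = keeps (op α) (parent∈A α α∈A α≢ρ)

_≟ₛ_ : (x y : BStr) → Dec (x ≡ y)
_≟ₛ_ = ≡-dec _≟_

avoidsFirstZeroLastOne : ∀ k {ρ op} → IsOpTree (10 + k) ρ op →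
                         ∃[ γ ] (NonRoot (10 + k) ρ γ × op γ ≢ firstZero × op γ ≢ lastOne)
avoidsFirstZeroLastOne k {ρ} T with ρ ≟ₛ onlyLastZero k
... | yes refl = noFirstZeroLastOne k , f ,
  parentOp-avoids T f firstZero (noFirstZeroLastOne-FirstZero-∉A k) ,
  parentOp-avoids T f lastOne (noFirstZeroLastOne-LastOne-∉A k)
  where f = noFirstZeroLastOne-∈A k , noFirstZeroLastOne≢onlyLastZero k
... | no ρ≢c = onlyLastZero k , c ,
  parentOp-avoids T c firstZero (onlyLastZero-FirstZero-∉A k) ,
  parentOp-avoids T c lastOne (onlyLastZero-LastOne-∉A k)
  where c = onlyLastZero-∈A k , λ c≡ρ → ρ≢c (sym c≡ρ)

threeOps : ∀ k {ρ op} → IsOpTree (10 + k) ρ op → ThreeOps (10 + k) ρ op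
threeOps k {ρ} T with ρ ≟ₛ onlyFirstZero k | ρ ≟ₛ onlyLastOne k
... | yes refl | _ = onlyLastOne k , onlyLastZero k , noLastOp k , b , c , d ,
  distinct₃ (parentOp-forced T b lastOne (onlyLastOne-keeps k))
            (parentOp-forced T c lastZero (onlyLastZero-keeps k)) (λ ())
            (parentOp-avoids T d lastOne (noLastOp-LastOne-∉A k))
            (parentOp-avoids T d lastZero (noLastOp-LastZero-∉A k))
  where
  b = onlyLastOne-∈A k , onlyLastOne≢onlyFirstZero k
  c = onlyLastZero-∈A k , onlyLastZero≢onlyFirstZero k
  d = noLastOp-∈A k , noLastOp≢onlyFirstZero k
... | no _ | yes refl = onlyFirstZero k , onlyLastZero k , noZeroOp k , a , c , e ,
  distinct₃ (parentOp-forced T a firstZero (onlyFirstZero-keeps k))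
            (parentOp-forced T c lastZero (onlyLastZero-keeps k)) (λ ())
            (parentOp-avoids T e firstZero (noZeroOp-FirstZero-∉A k))
            (parentOp-avoids T e lastZero (noZeroOp-LastZero-∉A k))
  where
  a = onlyFirstZero-∈A k , λ a≡b → onlyLastOne≢onlyFirstZero k (sym a≡b)
  c = onlyLastZero-∈A k , onlyLastZero≢onlyLastOne k
  e = noZeroOp-∈A k , noZeroOp≢onlyLastOne k
... | no ρ≢a | no ρ≢b =
  let γ , γ-nonRoot , γ≢firstZero , γ≢lastOne = avoidsFirstZeroLastOne k T in
  onlyFirstZero k , onlyLastOne k , γ , a , b , γ-nonRoot ,
  distinct₃ (parentOp-forced T a firstZero (onlyFirstZero-keeps k))
            (parentOp-forced T b lastOne (onlyLastOne-keeps k)) (λ ()) γ≢firstZero γ≢lastOne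
  where
  a = onlyFirstZero-∈A k , λ a≡ρ → ρ≢a (sym a≡ρ)
  b = onlyLastOne-∈A k , λ b≡ρ → ρ≢b (sym b≡ρ)

proposition1 : (n : ℕ) → 10 ≤ n → (ρ : BStr) → (op : BStr → Op) → IsOpTree n ρ op →
    ∃[ α ] ∃[ β ] ∃[ γ ] ((InA n α × ¬ α ≡ ρ) × (InA n β × ¬ β ≡ ρ) × (InA n γ × ¬ γ ≡ ρ)
      × ¬ op α ≡ op β × ¬ op α ≡ op γ × ¬ op β ≡ op γ)
proposition1 n 10≤n ρ op T with m≤n⇒∃[o]m+o≡n 10≤n
... | k , refl = threeOps k T
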